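{- The following Katětov–Blass relations hold: $\mathrm{fin}\times\mathrm{fin}\leq_{KB}\mathcal{NC}$, $\mathcal{ED}_{fin}\leq_{KB}\mathcal{NC}$, and $\mathcal{NC}\leq_{KB}\mathcal{G}_c$.
   Context: For ideals $\mathcal{I}$ on a countable set $X$ and $\mathcal{J}$ on a countable set $Y$, $\mathcal{I}\leq_{KB}\mathcal{J}$ means there is a finite-to-one $f:Y\to X$ with $f^{ -1}[I]\in\mathcal{J}$ for all $I\in\mathcal{I}$. For $A\subseteq\omega\times\omega$ and $n<\omega$, $A(n)=\{m:(n,m)\in A\}$. $\mathcal{NC}=\{A\subseteq\omega\times\omega:\ \text{for every } X\in[\omega]^\omega,\ \{A(n):n\in X\}\text{ is not centered}\}$, where a family of subsets of $\omega$ is centered if all its finite nonempty subfamilies have infinite intersection. $\mathrm{fin}\times\mathrm{fin}=\{A\subseteq\omega\times\omega:\exists n\ \forall m\geq n\ |A(m)|<\omega\}$. $\Delta=\{(n,m)\in\omega\times\omega:m\leq n\}$ and $\mathcal{ED}_{fin}=\{X\subseteq\Delta:\exists n\ \forall m\ |X(m)|\leq n\}$, an ideal on $\Delta$. $\mathcal{G}_c$ is the ideal on $[\omega]^2$ of all $E\subseteq[\omega]^2$ such that no infinite $Y\subseteq\omega$ satisfies $[Y]^2\subseteq E$. -}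

module Defs where

open import Level using (0ℓ; Lift)
import Level
open import Data.Nat using (ℕ; _≤_; _<_)
open import Data.Product using (Σ; ∃; _×_; _,_; proj₁; proj₂)
open import Data.List using (List; []; length)
open import Data.List.Membership.Propositional using (_∈_)
open import Data.List.Relation.Unary.All using (All)
open import Relation.Nullary using (¬_)
open import Relation.Unary using (Pred)
open import Relation.Binary.PropositionalEquality using (_≡_; _≢_)

-- Subsets of a set X are predicates on X; an ideal on X is given by its
-- membership predicate on subsets of X.
Subset : Set → Set₁
Subset X = Pred X 0ℓ

Family : Set → Set₂
Family X = Subset X → Set₁

Finite : {X : Set} → Subset X → Set
Finite {X} P = ∃ λ (xs : List X) → ∀ x → P x → x ∈ xs

Infinite : {X : Set} → Subset X → Set
Infinite P = ¬ Finite P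

AtMost : {X : Set} → ℕ → Subset X → Set
AtMost {X} n P = ∃ λ (xs : List X) → (length xs ≤ n) × (∀ x → P x → x ∈ xs)

FiniteToOne : {X Y : Set} → (Y → X) → Set
FiniteToOne {X} {Y} f = ∀ (x : X) → Finite (λ y → f y ≡ x)

_≤KB_ : {X Y : Set} → Family X → Family Y → Set₁
_≤KB_ {X} {Y} I J =
  Σ (Y → X) λ f → FiniteToOne f × (∀ (A : Subset X) → I A → J (λ y → A (f y)))

ωω : Set
ωω = ℕ × ℕ

section : Subset ωω → ℕ → Subset ℕ
section A n m = A (n , m)

Centered : Subset ωω → Subset ℕ → Set
Centered A X = ∀ (F : List ℕ) → F ≢ [] → All X F →
  Infinite (λ m → All (λ n → section A n m) F)

NC : Family ωω
NC A = Lift (Level.suc 0ℓ) (∀ (X : Subset ℕ) → Infinite X → ¬ Centered A X)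

fin×fin : Family ωω
fin×fin A = Lift (Level.suc 0ℓ) (∃ λ n → ∀ m → n ≤ m → Finite (section A m))

Δ : Set
Δ = Σ ωω (λ p → proj₂ p ≤ proj₁ p)

Δsection : Subset Δ → ℕ → Subset ℕ
Δsection X n m = Σ (m ≤ n) λ h → X ((n , m) , h)

ED-fin : Family Δ
ED-fin X = Lift (Level.suc 0ℓ) (∃ λ n → ∀ m → AtMost n (Δsection X m))

-- [ω]^2 as pairs (a,b) with a < b
Pairs : Set
Pairs = Σ ωω (λ p → proj₁ p < proj₂ p)

G-c : Family Pairs
G-c E = Lift (Level.suc 0ℓ) (¬ (Σ (Subset ℕ) λ Y → Infinite Y ×
  (∀ a b → (h : a < b) → Y a → Y b → E ((a , b) , h))))

-- Each reduction is witnessed by a simple finite-to-one map, and in each case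
-- a set of the ideal pulls back to a set whose sections cannot be centered on
-- an infinite X.  For fin×fin (map: identity) a single section far out in X is
-- already finite.  For ED-fin (map: folding ω×ω onto Δ by sorting a pair) any
-- k+1 points of X have a bounded common section, since a large m in it would
-- put k+1 points into the column of Δ over m.  For G-c (map: forgetting the
-- order proof of a pair) an infinite homogeneous Y is centered, because beyond
-- max F every point of Y lies in all sections over F ⊆ Y.
module Submission where

open import Defs
open import Level using (lift)
open import Data.Product using (Σ; ∃; _×_; _,_; proj₁)
open import Data.Nat using (ℕ; zero; suc; _≤_; _<_; _≤?_; _<?_; s≤s)
open import Data.Nat.Properties using (≤-irrelevant; <-irrelevant; ≰⇒>; ≰⇒≥; ≤-trans; <⇒≢; 1+n≰n)
open import Data.Fin using (Fin; zero; suc)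
open import Data.Fin.Properties using (injective⇒≤)
import Data.Vec.Functional as Vector
open import Data.List using (List; []; _∷_; [_]; _++_; upTo; tabulate; lookup; length)
open import Data.List.Relation.Unary.All using ([]; _∷_)
import Data.List.Relation.Unary.All as All
open import Data.List.Relation.Unary.All.Properties using (tabulate⁺; tabulate⁻)
open import Data.List.Relation.Unary.Any using (here; there; index)
open import Data.List.Relation.Unary.Any.Properties using (lookup-index)
open import Data.List.Membership.Propositional using (_∈_)
open import Data.List.Membership.Propositional.Properties using (∈-upTo⁺; ∈-++⁺ˡ; ∈-++⁺ʳ)
open import Data.List.Extrema.Nat using (max; xs≤max)
open import Data.Empty using (⊥-elim)
open import Function using (id)
open import Function.Definitions using (Injective)
open import Relation.Nullary using (¬_; yes; no)
open import Relation.Unary using (_⊆_; Decidable; Irrelevant)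
open import Relation.Binary.PropositionalEquality using (_≡_; _≢_; refl; sym; trans; cong; subst)

finite-⊆ : {X : Set} {P Q : Subset X} → P ⊆ Q → Finite Q → Finite P
finite-⊆ P⊆Q (xs , cover) = xs , λ x Px → cover x (P⊆Q Px)

finite-if-covered-above : {P : Subset ℕ} (b : ℕ) (xs : List ℕ) →
  (∀ x → P x → b ≤ x → x ∈ xs) → Finite P
finite-if-covered-above {P} b xs cover = upTo b ++ xs , covered
  where
  covered : ∀ x → P x → x ∈ upTo b ++ xs
  covered x Px with b ≤? x
  ... | yes b≤x = ∈-++⁺ʳ (upTo b) (cover x Px b≤x)
  ... | no b≰x = ∈-++⁺ˡ (∈-upTo⁺ (≰⇒> b≰x))

infinite⇒¬¬unbounded : {P : Subset ℕ} → Infinite P → ∀ b → ¬ ¬ (∃ λ x → b ≤ x × P x)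
infinite⇒¬¬unbounded P-infinite b none =
  P-infinite (finite-if-covered-above b [] λ x Px b≤x → ⊥-elim (none (x , b≤x , Px)))

≤-max : {k : ℕ} (g : Fin k → ℕ) → ∀ i → g i ≤ max 0 (tabulate g)
≤-max g = tabulate⁻ (xs≤max 0 (tabulate g))

∷-injective : {A : Set} {k : ℕ} {x : A} {g : Fin k → A} →
  Injective _≡_ _≡_ g → (∀ i → g i ≢ x) → Injective _≡_ _≡_ (x Vector.∷ g)
∷-injective g-inj x-fresh {zero} {zero} _ = refl
∷-injective g-inj x-fresh {zero} {suc j} e = ⊥-elim (x-fresh j (sym e))
∷-injective g-inj x-fresh {suc i} {zero} e = ⊥-elim (x-fresh i e)
∷-injective g-inj x-fresh {suc i} {suc j} e = cong suc (g-inj e)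

infinite⇒¬¬injection : {S : Subset ℕ} → Infinite S → ∀ k →
  ¬ ¬ (Σ (Fin k → ℕ) λ g → Injective _≡_ _≡_ g × (∀ i → S (g i)))
infinite⇒¬¬injection S-infinite zero none = none ((λ ()) , (λ { {()} }) , λ ())
infinite⇒¬¬injection S-infinite (suc k) none =
  infinite⇒¬¬injection S-infinite k λ (g , g-inj , Sg) →
  infinite⇒¬¬unbounded S-infinite (suc (max 0 (tabulate g))) λ (x , b≤x , Sx) →
  none (x Vector.∷ g , ∷-injective g-inj (fresh g b≤x) , λ { zero → Sx ; (suc i) → Sg i })
  where
  fresh : ∀ {x} (g : Fin k → ℕ) → suc (max 0 (tabulate g)) ≤ x → ∀ i → g i ≢ x
  fresh g b≤x i = <⇒≢ (≤-trans (s≤s (≤-max g i)) b≤x)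

AtMost-¬injection : {X : Set} {P : Subset X} {k : ℕ} → AtMost k P →
  (g : Fin (suc k) → X) → Injective _≡_ _≡_ g → ¬ (∀ i → P (g i))
AtMost-¬injection {k = k} (xs , |xs|≤k , cover) g g-inj Pg =
  1+n≰n (≤-trans (injective⇒≤ position-injective) |xs|≤k)
  where
  position : Fin (suc k) → Fin (length xs)
  position i = index (cover (g i) (Pg i))
  position-injective : Injective _≡_ _≡_ position
  position-injective {i} {j} e = g-inj (trans (lookup-index (cover (g i) (Pg i)))
    (trans (cong (lookup xs) e) (sym (lookup-index (cover (g j) (Pg j))))))

id-finiteToOne : {X : Set} → FiniteToOne (id {A = X})
id-finiteToOne x = [ x ] , λ { _ refl → here refl }

proj₁-finiteToOne : {X : Set} {P : Subset X} → Decidable P → Irrelevant P →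
  FiniteToOne (proj₁ {B = P})
proj₁-finiteToOne P? P-irr x with P? x
... | yes p = [ x , p ] , λ { (_ , q) refl → here (cong (x ,_) (P-irr q p)) }
... | no ¬p = [] , λ { (_ , q) refl → ⊥-elim (¬p q) }

sortPair : ωω → Δ
sortPair (n , m) with n ≤? m
... | yes n≤m = (m , n) , n≤m
... | no n≰m = (n , m) , ≰⇒≥ n≰m

sortPair-≤ : ∀ {n m} (n≤m : n ≤ m) → sortPair (n , m) ≡ ((m , n) , n≤m)
sortPair-≤ {n} {m} n≤m with n ≤? m
... | yes n≤m′ = cong ((m , n) ,_) (≤-irrelevant n≤m′ n≤m)
... | no n≰m = ⊥-elim (n≰m n≤m)

sortPair-finiteToOne : FiniteToOne sortPair
sortPair-finiteToOne ((a , b) , b≤a) = (b , a) ∷ (a , b) ∷ [] , covered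
  where
  covered : ∀ p → sortPair p ≡ ((a , b) , b≤a) → p ∈ (b , a) ∷ (a , b) ∷ []
  covered (n , m) e with n ≤? m
  covered (n , m) refl | yes _ = here refl
  covered (n , m) refl | no _ = there (here refl)

fin×fin⊆NC : fin×fin ⊆ NC
fin×fin⊆NC (lift (n , finite-beyond)) = lift λ X X-infinite centered →
  infinite⇒¬¬unbounded X-infinite n λ (x , n≤x , Xx) →
  centered [ x ] (λ ()) (Xx ∷ []) (finite-⊆ All.head (finite-beyond x n≤x))

ED-fin⇒NC∘sortPair : {X : Subset Δ} → ED-fin X → NC (λ p → X (sortPair p))
ED-fin⇒NC∘sortPair {X} (lift (k , small-columns)) = lift λ S S-infinite centered →
  infinite⇒¬¬injection S-infinite (suc k) λ (g , g-inj , Sg) →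
  centered (tabulate g) (λ ()) (tabulate⁺ Sg)
    (finite-if-covered-above (max 0 (tabulate g)) [] λ m in-all max≤m →
      ⊥-elim (AtMost-¬injection (small-columns m) g g-inj
        (in-column g (tabulate⁻ in-all) λ i → ≤-trans (≤-max g i) max≤m)))
  where
  in-column : ∀ {m} (g : Fin (suc k) → ℕ) → (∀ i → X (sortPair (g i , m))) → (∀ i → g i ≤ m) →
    ∀ i → Δsection X m (g i)
  in-column g in-all below i = below i , subst X (sortPair-≤ (below i)) (in-all i)

homogeneous⇒centered : {A : Subset ωω} {Y : Subset ℕ} →
  (∀ a b → a < b → Y a → Y b → A (a , b)) → Infinite Y → Centered A Y
homogeneous⇒centered homogeneous Y-infinite F _ F⊆Y (xs , cover) =
  Y-infinite (finite-if-covered-above (suc (max 0 F)) xs λ y Yy max<y →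
    cover y (All.zipWith (λ (n≤max , Yn) → homogeneous _ y (≤-trans (s≤s n≤max) max<y) Yn Yy)
      (xs≤max 0 F , F⊆Y)))

NC⇒G-c∘proj₁ : {A : Subset ωω} → NC A → G-c (λ e → A (proj₁ e))
NC⇒G-c∘proj₁ (lift not-centered) = lift λ (Y , Y-infinite , homogeneous) →
  not-centered Y Y-infinite (homogeneous⇒centered homogeneous Y-infinite)

proposition4p3 : (fin×fin ≤KB NC) × (ED-fin ≤KB NC) × (NC ≤KB G-c)
proposition4p3 =
  (id , id-finiteToOne , λ _ → fin×fin⊆NC) ,
  (sortPair , sortPair-finiteToOne , λ _ → ED-fin⇒NC∘sortPair) ,
  (proj₁ , proj₁-finiteToOne (λ (a , b) → a <? b) <-irrelevant , λ _ → NC⇒G-c∘proj₁)
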